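{- Let $r>s\ge 2$ and $m\ge 1$ be integers, let $\rho=r/\gcd\{r,s\}$, $\sigma=s/\gcd\{r,s\}$, and $$N_2'=1+s(r-1)\frac{[(r-1)(s-1)]^{m}-1}{(r-1)(s-1)-1}.$$ Suppose that $\rho$ divides $s\frac{[(r-1)(s-1)]^{m}-1}{(r-1)(s-1)-1}-1$. Then no bipartite biregular graph with degrees $r,s$ and diameter $2m+1$ has order equal to $M(r,s;2m+1)=\lfloor N_2'/\rho\rfloor(\rho+\sigma)$. Instead, every such graph $G=(V_1\cup V_2,E)$ (vertices of $V_1$ of degree $r$, of $V_2$ of degree $s$) satisfies $|V_1|\le \left(\frac{N_2'}{\rho}-1\right)\sigma$ and $|V_2|\le\left(\frac{N_2'}{\rho}-1\right)\rho$, so its order is at most $$M^*(r,s;2m+1)=\left(\frac{N_2'}{\rho}-1\right)(\rho+\sigma).$$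
   Context: A bipartite graph with stable sets $V_1,V_2$ is biregular with degrees $r,s$ if all vertices of $V_1$ have degree $r$ and all vertices of $V_2$ have degree $s$; its order is $|V_1|+|V_2|$. -}

module Defs where

open import Data.Nat using (ℕ; zero; suc; _+_; _*_; _∸_; _^_; _/_)
open import Data.Nat.GCD using (gcd)
open import Data.Bool using (Bool; true; false; if_then_else_; T; not)
open import Data.Fin using (Fin)
open import Data.List using (List; map)
open import Data.Nat.ListAction using (sum)
open import Data.Product using (Σ; ∃; _×_; _,_)
open import Relation.Binary.PropositionalEquality using (_≡_; _≢_)
open import Relation.Nullary using (¬_)
open import Data.Nat using (_≤_; _<_)
import Data.List

allFin : (n : ℕ) → List (Fin n)
allFin n = Data.List.allFin n

count : {n : ℕ} → (Fin n → Bool) → ℕ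
count {n} p = sum (map (λ u → if p u then 1 else 0) (allFin n))

-- Floor division on ℕ (convention: division by 0 gives 0; never used with 0 here)
divℕ : ℕ → ℕ → ℕ
divℕ a zero = 0
divℕ a (suc b) = a / suc b

record SimpleGraph (n : ℕ) : Set where
  field
    adj    : Fin n → Fin n → Bool
    sym    : ∀ u v → adj u v ≡ adj v u
    irrefl : ∀ u → adj u u ≡ false

open SimpleGraph public

degree : {n : ℕ} → SimpleGraph n → Fin n → ℕ
degree G v = count (λ u → adj G v u)

data Walk {n : ℕ} (G : SimpleGraph n) : Fin n → Fin n → ℕ → Set where
  nil  : ∀ {u} → Walk G u u 0
  cons : ∀ {u w v k} → T (adj G u w) → Walk G w v k → Walk G u v (suc k)

HasDiameter : {n : ℕ} → SimpleGraph n → ℕ → Set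
HasDiameter {n} G D =
  (∀ (u v : Fin n) → Σ ℕ (λ k → k ≤ D × Walk G u v k))
  × Σ (Fin n) (λ u → Σ (Fin n) (λ v → ∀ k → k < D → ¬ Walk G u v k))

record BiregularBipartite (n r s : ℕ) (G : SimpleGraph n) : Set where
  field
    side     : Fin n → Bool
    stable   : ∀ u v → T (adj G u v) → side u ≢ side v
    degV₁    : ∀ v → side v ≡ true  → degree G v ≡ r
    degV₂    : ∀ v → side v ≡ false → degree G v ≡ s

open BiregularBipartite public

sizeV₁ : {n r s : ℕ} {G : SimpleGraph n} → BiregularBipartite n r s G → ℕ
sizeV₁ B = count (side B)

sizeV₂ : {n r s : ℕ} {G : SimpleGraph n} → BiregularBipartite n r s G → ℕ
sizeV₂ B = count (λ v → not (side B v))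

-- geometric sum  Σ_{i<m} q^i  =  (q^m - 1)/(q - 1)  for q ≥ 2
geomSum : ℕ → ℕ → ℕ
geomSum q zero = 0
geomSum q (suc m) = q ^ m + geomSum q m

ρ : ℕ → ℕ → ℕ
ρ r s = divℕ r (gcd r s)

σ : ℕ → ℕ → ℕ
σ r s = divℕ s (gcd r s)

X : ℕ → ℕ → ℕ → ℕ
X r s m = geomSum ((r ∸ 1) * (s ∸ 1)) m

N₂′ : ℕ → ℕ → ℕ → ℕ
N₂′ r s m = 1 + s * (r ∸ 1) * X r s m

M : ℕ → ℕ → ℕ → ℕ
M r s m = divℕ (N₂′ r s m) (ρ r s) * (ρ r s + σ r s)

K : ℕ → ℕ → ℕ → ℕ
K r s m = divℕ (N₂′ r s m) (ρ r s) ∸ 1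

M* : ℕ → ℕ → ℕ → ℕ
M* r s m = K r s m * (ρ r s + σ r s)

-- Counting layer by layer from a vertex u of V₂ (a Moore-type bound) gives |V₂| ≤ N₂′, with equality only if
-- the ball of radius 2m around u is a tree: every vertex of a sphere has a unique neighbour closer to u.
-- If that holds around every vertex of V₂, it also holds around each vertex v of V₁, and counting from v gives
-- |V₁| ≥ 1 + r(s-1)X; as r > s this contradicts r|V₁| = s|V₂| ≤ sN₂′. Hence |V₂| < N₂′. Now r|V₁| = s|V₂|
-- forces |V₂| = tρ and |V₁| = tσ, while the divisibility hypothesis makes N₂′ = cρ, so t ≤ c - 1.

module Submission where

open import Defs hiding (sym)
open import Data.Nat using (ℕ; zero; suc; _+_; _*_; _∸_; _^_; _≤_; _<_; z≤n; s≤s; _≤?_; _/_; NonZero; ≢-nonZero; >-nonZero)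
open import Data.Nat.Properties hiding (_≟_)
open import Data.Nat.ListAction using (sum)
open import Data.Nat.Divisibility using (_∣_; divides; ∣m+n∣m⇒∣n; ∣m⇒∣m*n)
open import Data.Nat.DivMod using (m/n*n≡m; m*n/n≡m)
open import Data.Nat.GCD using (gcd; gcd[m,n]∣m; gcd[m,n]∣n; gcd[m,n]≢0)
open import Data.Nat.Coprimality using (Coprime; coprime-/gcd; coprime-divisor)
open import Data.Nat.Tactic.RingSolver using (solve-∀)
open import Data.Bool using (Bool; true; false; if_then_else_; not; _∧_; _∨_; T)
open import Data.Bool.Properties using (T-≡; ∧-zeroʳ; if-cong; ¬-not; not-involutive)
open import Data.Bool.ListAction using (any)
open import Data.Fin using (Fin; _≟_)
open import Data.List using (List; []; _∷_; map; length)
open import Data.List.Properties using (length-tabulate)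
open import Data.List.Membership.Propositional using (_∈_; lose)
open import Data.List.Membership.Propositional.Properties using (∈-allFin)
open import Data.List.Relation.Unary.Any using (here; there; satisfied)
open import Data.List.Relation.Unary.Any.Properties using (any⁺; any⁻)
import Data.List.Relation.Unary.All as All
import Data.List.Relation.Unary.AllPairs as AllPairs
open import Data.List.Relation.Unary.Unique.Propositional using (Unique)
open import Data.List.Relation.Unary.Unique.Propositional.Properties using (allFin⁺)
open import Data.Product using (Σ; ∃; _×_; _,_; proj₁; proj₂)
open import Data.Sum using (_⊎_; inj₁; inj₂)
open import Data.Empty using (⊥; ⊥-elim)
open import Function using (Equivalence; _$_)
open import Relation.Binary.PropositionalEquality
open import Relation.Nullary using (Dec; yes; no)
open import Relation.Nullary.Decidable using (⌊_⌋)

true≢false : ∀ {b} → b ≡ true → b ≢ false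
true≢false refl ()

≢true⇒false : ∀ {b} → b ≢ true → b ≡ false
≢true⇒false {false} _  = refl
≢true⇒false {true}  b≢ = ⊥-elim (b≢ refl)

bool-cases : (b : Bool) → b ≡ true ⊎ b ≡ false
bool-cases true  = inj₁ refl
bool-cases false = inj₂ refl

∨-introˡ : ∀ {a b} → a ≡ true → a ∨ b ≡ true
∨-introˡ refl = refl

∨-introʳ : ∀ {a b} → b ≡ true → a ∨ b ≡ true
∨-introʳ {true}  _ = refl
∨-introʳ {false} e = e

∨-elim : ∀ {a b} → a ∨ b ≡ true → a ≡ true ⊎ b ≡ true
∨-elim {true}  _ = inj₁ refl
∨-elim {false} e = inj₂ e

∧-intro : ∀ {a b} → a ≡ true → b ≡ true → a ∧ b ≡ true
∧-intro refl refl = refl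

∧-elim : ∀ {a b} → a ∧ b ≡ true → a ≡ true × b ≡ true
∧-elim {true} e = refl , e

not-true⇒false : ∀ {a} → not a ≡ true → a ≡ false
not-true⇒false {false} _ = refl

false⇒not-true : ∀ {a} → a ≡ false → not a ≡ true
false⇒not-true refl = refl

≡true⇒T : ∀ {b} → b ≡ true → T b
≡true⇒T = Equivalence.from T-≡

-- Sums and counts over lists

module _ {A : Set} where

  ∑ : List A → (A → ℕ) → ℕ
  ∑ l f = sum (map f l)

  ∑-cong : (l : List A) {f g : A → ℕ} → (∀ x → f x ≡ g x) → ∑ l f ≡ ∑ l g
  ∑-cong []      f≡g = refl
  ∑-cong (x ∷ l) f≡g = cong₂ _+_ (f≡g x) (∑-cong l f≡g)

  ∑-mono-≤ : (l : List A) {f g : A → ℕ} → (∀ x → f x ≤ g x) → ∑ l f ≤ ∑ l g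
  ∑-mono-≤ []      f≤g = z≤n
  ∑-mono-≤ (x ∷ l) f≤g = +-mono-≤ (f≤g x) (∑-mono-≤ l f≤g)

  ∑-mono-< : (l : List A) {f g : A → ℕ} {x : A} → x ∈ l →
             (∀ y → f y ≤ g y) → f x < g x → ∑ l f < ∑ l g
  ∑-mono-< (_ ∷ l)     (here refl) f≤g fx<gx = +-mono-<-≤ fx<gx (∑-mono-≤ l f≤g)
  ∑-mono-< (y ∷ l)     (there x∈l) f≤g fx<gx = +-mono-≤-< (f≤g y) (∑-mono-< l x∈l f≤g fx<gx)

  ∑-zero : (l : List A) → ∑ l (λ _ → 0) ≡ 0
  ∑-zero []      = refl
  ∑-zero (_ ∷ l) = ∑-zero l

  ∑-distrib-+ : (l : List A) (f g : A → ℕ) → ∑ l (λ x → f x + g x) ≡ ∑ l f + ∑ l g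
  ∑-distrib-+ []      f g = refl
  ∑-distrib-+ (x ∷ l) f g rewrite ∑-distrib-+ l f g = interchange (f x) (g x) (∑ l f) (∑ l g)
    where
    interchange : ∀ a b c d → a + b + (c + d) ≡ a + c + (b + d)
    interchange = solve-∀

  ∑-distribˡ-* : (l : List A) (d : ℕ) (f : A → ℕ) → ∑ l (λ x → d * f x) ≡ d * ∑ l f
  ∑-distribˡ-* []      d f = sym (*-zeroʳ d)
  ∑-distribˡ-* (x ∷ l) d f rewrite ∑-distribˡ-* l d f = sym (*-distribˡ-+ d (f x) (∑ l f))

  term≤∑ : {l : List A} {x : A} (f : A → ℕ) → x ∈ l → f x ≤ ∑ l f
  term≤∑         f (here refl) = m≤m+n _ _
  term≤∑ {y ∷ l} f (there x∈l) = ≤-trans (term≤∑ f x∈l) (m≤n+m _ (f y))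

module _ {A B : Set} where

  ∑-comm : (l₁ : List A) (l₂ : List B) (F : A → B → ℕ) →
           ∑ l₁ (λ a → ∑ l₂ (F a)) ≡ ∑ l₂ (λ b → ∑ l₁ (λ a → F a b))
  ∑-comm []       l₂ F = sym (∑-zero l₂)
  ∑-comm (a ∷ l₁) l₂ F rewrite ∑-comm l₁ l₂ F = sym (∑-distrib-+ l₂ (F a) (λ b → ∑ l₁ (λ a → F a b)))

module _ {A : Set} where

  indicator : (A → Bool) → A → ℕ
  indicator p x = if p x then 1 else 0

  countIn : List A → (A → Bool) → ℕ
  countIn l p = ∑ l (indicator p)

  countIn-mono : (l : List A) {p q : A → Bool} →
                 (∀ x → p x ≡ true → q x ≡ true) → countIn l p ≤ countIn l q
  countIn-mono l {p} {q} p⇒q = ∑-mono-≤ l pointwise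
    where
    pointwise : ∀ x → indicator p x ≤ indicator q x
    pointwise x with p x in px
    ... | false = z≤n
    ... | true rewrite p⇒q x px = ≤-refl

  countIn-∨ : (l : List A) {p q r : A → Bool} →
              (∀ x → p x ≡ true → (q x ∨ r x) ≡ true) → countIn l p ≤ countIn l q + countIn l r
  countIn-∨ l {p} {q} {r} p⇒q∨r =
    subst (countIn l p ≤_) (∑-distrib-+ l (indicator q) (indicator r)) (∑-mono-≤ l pointwise)
    where
    pointwise : ∀ x → indicator p x ≤ indicator q x + indicator r x
    pointwise x with p x in px
    ... | false = z≤n
    ... | true with q x | p⇒q∨r x px
    ...   | true  | _   = s≤s z≤n
    ...   | false | r≡t rewrite r≡t = ≤-refl

  countIn-disjoint : (l : List A) {p q r : A → Bool} →
                     (∀ x → q x ≡ true → p x ≡ true) → (∀ x → r x ≡ true → p x ≡ true) →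
                     (∀ x → q x ≡ true → r x ≡ true → ⊥) → countIn l q + countIn l r ≤ countIn l p
  countIn-disjoint l {p} {q} {r} q⇒p r⇒p disjoint =
    subst (_≤ countIn l p) (∑-distrib-+ l (indicator q) (indicator r)) (∑-mono-≤ l pointwise)
    where
    pointwise : ∀ x → indicator q x + indicator r x ≤ indicator p x
    pointwise x with q x in qx | r x in rx
    ... | true  | true  = ⊥-elim (disjoint x qx rx)
    ... | true  | false rewrite q⇒p x qx = ≤-refl
    ... | false | true  rewrite r⇒p x rx = ≤-refl
    ... | false | false = z≤n

  countIn-+-not : (l : List A) (p : A → Bool) → countIn l p + countIn l (λ x → not (p x)) ≡ length l
  countIn-+-not []      p = refl
  countIn-+-not (x ∷ l) p with p x
  ... | true  = cong suc (countIn-+-not l p)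
  ... | false = trans (+-suc _ _) (cong suc (countIn-+-not l p))

  countIn-none : (l : List A) {p : A → Bool} → (∀ x → x ∈ l → p x ≡ false) → countIn l p ≡ 0
  countIn-none []      none = refl
  countIn-none (x ∷ l) {p} none rewrite none x (here refl) = countIn-none l (λ y y∈l → none y (there y∈l))

  countIn-witness : (l : List A) (p : A → Bool) → 1 ≤ countIn l p → ∃ λ x → p x ≡ true
  countIn-witness (x ∷ l) p pos with p x in px
  ... | true  = x , px
  ... | false = countIn-witness l p pos

  countIn-member : {l : List A} {x : A} (p : A → Bool) → x ∈ l → p x ≡ true → 1 ≤ countIn l p
  countIn-member {l} p x∈l px = subst (λ b → (if b then 1 else 0) ≤ countIn l p) px (term≤∑ (indicator p) x∈l)

  countIn≤1⇒unique : {l : List A} (p : A → Bool) → countIn l p ≤ 1 →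
                     {x y : A} → x ∈ l → y ∈ l → p x ≡ true → p y ≡ true → x ≡ y
  countIn≤1⇒unique         p c≤1 (here refl) (here refl) px py = refl
  countIn≤1⇒unique {z ∷ l} p c≤1 (here refl) (there y∈l) px py
    rewrite px = ⊥-elim (<⇒≱ (s≤s (countIn-member p y∈l py)) c≤1)
  countIn≤1⇒unique {z ∷ l} p c≤1 (there x∈l) (here refl) px py
    rewrite py = ⊥-elim (<⇒≱ (s≤s (countIn-member p x∈l px)) c≤1)
  countIn≤1⇒unique {z ∷ l} p c≤1 (there x∈l) (there y∈l) px py =
    countIn≤1⇒unique p (≤-trans (m≤n+m _ (indicator p z)) c≤1) x∈l y∈l px py

  unique⇒countIn≤1 : {l : List A} → Unique l → (p : A → Bool) →
                     (∀ x y → p x ≡ true → p y ≡ true → x ≡ y) → countIn l p ≤ 1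
  unique⇒countIn≤1 {[]}    _ p uniq = z≤n
  unique⇒countIn≤1 {x ∷ l} (x∉l AllPairs.∷ distinct) p uniq with p x in px
  ... | false = unique⇒countIn≤1 distinct p uniq
  ... | true  = ≤-reflexive (cong suc (countIn-none l none))
    where
    none : ∀ y → y ∈ l → p y ≡ false
    none y y∈l with p y in py
    ... | false = refl
    ... | true  = ⊥-elim (All.lookup x∉l y∈l (uniq x y px py))

  ∑-if-const : (l : List A) (p : A → Bool) (f : A → ℕ) (d : ℕ) → (∀ x → p x ≡ true → f x ≡ d) →
               ∑ l (λ x → if p x then f x else 0) ≡ d * countIn l p
  ∑-if-const l p f d f≡d = trans (∑-cong l pointwise) (∑-distribˡ-* l d (indicator p))
    where
    pointwise : ∀ x → (if p x then f x else 0) ≡ d * indicator p x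
    pointwise x with p x in px
    ... | true  = trans (f≡d x px) (sym (*-identityʳ d))
    ... | false = sym (*-zeroʳ d)

-- Arithmetic of the Moore bound

prefixSum : (ℕ → ℕ) → ℕ → ℕ
prefixSum f zero    = 0
prefixSum f (suc j) = prefixSum f j + f (suc j)

prefixSum≡0 : ∀ f J → prefixSum f J ≡ 0 → ∀ j → 1 ≤ j → j ≤ J → f j ≡ 0
prefixSum≡0 f zero    _     j 1≤j j≤0 = ⊥-elim (<⇒≱ 1≤j j≤0)
prefixSum≡0 f (suc J) sum≡0 j 1≤j j≤J with m≤n⇒m<n∨m≡n j≤J
... | inj₂ refl = m+n≡0⇒n≡0 (prefixSum f J) sum≡0
... | inj₁ j<J  = prefixSum≡0 f J (m+n≡0⇒m≡0 (prefixSum f J) sum≡0) j 1≤j (≤-pred j<J)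

-- One layer of the Moore-bound induction: a layer of degree d + 1 with size vertices, down edges to the
-- previous layer (an excess e over size) and up edges to the next; H bounds down plus the excess S so far.
moore-step : ∀ d up down size e S H → 1 ≤ d →
             up + down ≤ suc d * size → size + e ≡ down → down + S ≤ H →
             (up + (S + e) ≤ d * H) × (size + (S + e) ≤ H)
moore-step d@(suc d′) up down size e S H _ up+down≤ size+e≡down down+S≤H = up-bound , size-bound
  where
  open ≤-Reasoning
  size-bound : size + (S + e) ≤ H
  size-bound = begin
    size + (S + e) ≡⟨ shuffle size S e ⟩
    (size + e) + S ≡⟨ cong (_+ S) size+e≡down ⟩
    down + S       ≤⟨ down+S≤H ⟩
    H              ∎
    where
    shuffle : ∀ a S e → a + (S + e) ≡ (a + e) + S
    shuffle = solve-∀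
  up+e≤d*size : up + e ≤ d * size
  up+e≤d*size = +-cancelˡ-≤ size _ _ (begin
    size + (up + e) ≡⟨ shuffle size up e ⟩
    up + (size + e) ≡⟨ cong (up +_) size+e≡down ⟩
    up + down       ≤⟨ up+down≤ ⟩
    suc d * size    ∎)
    where
    shuffle : ∀ a u e → a + (u + e) ≡ u + (a + e)
    shuffle = solve-∀
  up-bound : up + (S + e) ≤ d * H
  up-bound = begin
    up + (S + e)                       ≡⟨ shuffle up S e ⟩
    (up + e) + S                       ≤⟨ +-monoˡ-≤ S up+e≤d*size ⟩
    d * size + S                       ≤⟨ +-monoʳ-≤ (d * size) (m≤m+n S (e + d′ * (e + S))) ⟩
    d * size + (S + (e + d′ * (e + S))) ≡⟨ expand d′ size e S ⟩
    d * ((size + e) + S)               ≡⟨ cong (λ t → d * (t + S)) size+e≡down ⟩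
    d * (down + S)                     ≤⟨ *-monoʳ-≤ d down+S≤H ⟩
    d * H                              ∎
    where
    shuffle : ∀ u S e → u + (S + e) ≡ (u + e) + S
    shuffle = solve-∀
    expand : ∀ d′ a e S → suc d′ * a + (S + (e + d′ * (e + S))) ≡ suc d′ * ((a + e) + S)
    expand = solve-∀

d*x≤y+x⇒[d∸1]*x≤y : ∀ d x y → 1 ≤ d → d * x ≤ y + x → (d ∸ 1) * x ≤ y
d*x≤y+x⇒[d∸1]*x≤y (suc d) x y _ ≤y+x = +-cancelʳ-≤ x _ _ (subst (_≤ y + x) (+-comm x (d * x)) ≤y+x)

s*[1+s[r∸1]X]<r*[1+r[s∸1]X] : ∀ r s X → s < r → 2 ≤ s →
                              s * (1 + s * (r ∸ 1) * X) < r * (1 + r * (s ∸ 1) * X)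
s*[1+s[r∸1]X]<r*[1+r[s∸1]X] _ (suc zero) X _ (s≤s ())
s*[1+s[r∸1]X]<r*[1+r[s∸1]X] (suc (suc r′)) (suc (suc a)) X (s≤s (s≤s a<r′)) _
  with r′ ∸ suc a | m+[n∸m]≡n a<r′
... | b | refl = subst (lhs <_) (identity a b X) (m<m+n lhs (s≤s z≤n))
  where
  lhs : ℕ
  lhs = suc (suc a) * (1 + suc (suc a) * suc (suc (a + b)) * X)
  -- s = a + 2 and r = a + b + 3
  identity : ∀ a b X → suc (suc a) * (1 + suc (suc a) * suc (suc (a + b)) * X)
                     + suc (b + suc b * (a * a + a * b + 3 * a + b + 1) * X)
                     ≡ suc (suc (suc (a + b))) * (1 + suc (suc (suc (a + b))) * suc a * X)
  identity = solve-∀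

-- Balls and spheres in a simple graph

module Balls {n : ℕ} (G : SimpleGraph n) where

  infix 7 _~_
  _~_ : Fin n → Fin n → Bool
  _~_ = adj G

  ~-sym : ∀ {u v} → u ~ v ≡ true → v ~ u ≡ true
  ~-sym {u} {v} = trans (SimpleGraph.sym G v u)

  allF : List (Fin n)
  allF = allFin n

  hasNeighbourIn : Fin n → (Fin n → Bool) → Bool
  hasNeighbourIn y S = any (λ z → y ~ z ∧ S z) allF

  hasNeighbourIn⁻ : ∀ {y S} → hasNeighbourIn y S ≡ true → ∃ λ z → y ~ z ≡ true × S z ≡ true
  hasNeighbourIn⁻ {y} {S} e with satisfied (any⁻ (λ z → y ~ z ∧ S z) allF (≡true⇒T e))
  ... | z , t = z , ∧-elim (Equivalence.to T-≡ t)

  hasNeighbourIn⁺ : ∀ {y S z} → y ~ z ≡ true → S z ≡ true → hasNeighbourIn y S ≡ true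
  hasNeighbourIn⁺ {y} {S} {z} y~z Sz =
    Equivalence.to T-≡ (any⁺ _ (lose (∈-allFin z) (≡true⇒T (∧-intro {y ~ z} y~z Sz))))

  ≟-true : ∀ {y x : Fin n} → ⌊ y ≟ x ⌋ ≡ true → y ≡ x
  ≟-true {y} {x} e with y ≟ x
  ... | yes y≡x = y≡x

  ≟-refl : (x : Fin n) → ⌊ x ≟ x ⌋ ≡ true
  ≟-refl x with x ≟ x
  ... | yes _  = refl
  ... | no x≢x = ⊥-elim (x≢x refl)

  -- Ball x k is the set of vertices at distance < k from x, so Sphere x k is the set at distance exactly k.
  opaque
    Ball : Fin n → ℕ → Fin n → Bool
    Ball x zero    y = false
    Ball x (suc k) y = ⌊ y ≟ x ⌋ ∨ (Ball x k y ∨ hasNeighbourIn y (Ball x k))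

    ball-0 : ∀ {x y} → Ball x 0 y ≡ false
    ball-0 = refl

    ball-centre : ∀ x k → Ball x (suc k) x ≡ true
    ball-centre x k = ∨-introˡ (≟-refl x)

    ball-suc : ∀ {x k y} → Ball x k y ≡ true → Ball x (suc k) y ≡ true
    ball-suc {x} {k} {y} e = ∨-introʳ {⌊ y ≟ x ⌋} (∨-introˡ e)

    ball-adj : ∀ {x k y z} → y ~ z ≡ true → Ball x k z ≡ true → Ball x (suc k) y ≡ true
    ball-adj {x} {k} {y} y~z z∈B = ∨-introʳ {⌊ y ≟ x ⌋} (∨-introʳ {Ball x k y} (hasNeighbourIn⁺ y~z z∈B))

    ball-suc⁻ : ∀ {x k y} → Ball x (suc k) y ≡ true →
                y ≡ x ⊎ Ball x k y ≡ true ⊎ ∃ λ z → y ~ z ≡ true × Ball x k z ≡ true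
    ball-suc⁻ {x} {k} {y} e with ∨-elim {⌊ y ≟ x ⌋} e
    ... | inj₁ y≡x = inj₁ (≟-true y≡x)
    ... | inj₂ e′ with ∨-elim {Ball x k y} e′
    ...   | inj₁ y∈B = inj₂ (inj₁ y∈B)
    ...   | inj₂ y~B = inj₂ (inj₂ (hasNeighbourIn⁻ y~B))

  ball-mono : ∀ {x k k′ y} → k ≤ k′ → Ball x k y ≡ true → Ball x k′ y ≡ true
  ball-mono {x} {zero} {y = y} _ e = ⊥-elim (true≢false e (ball-0 {x} {y}))
  ball-mono {x} {suc k} {suc k′} {y} (s≤s k≤k′) e with ball-suc⁻ {x} {k} {y} e
  ... | inj₁ refl                   = ball-centre x k′
  ... | inj₂ (inj₁ y∈B)             = ball-suc {x} {k′} {y} (ball-mono {k = k} k≤k′ y∈B)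
  ... | inj₂ (inj₂ (z , y~z , z∈B)) = ball-adj {x} {k′} {y} y~z (ball-mono {k = k} k≤k′ z∈B)

  ball-1 : ∀ {x y} → Ball x 1 y ≡ true → y ≡ x
  ball-1 {x} {y} e with ball-suc⁻ {x} {0} {y} e
  ... | inj₁ y≡x                  = y≡x
  ... | inj₂ (inj₁ y∈B)           = ⊥-elim (true≢false y∈B (ball-0 {x} {y}))
  ... | inj₂ (inj₂ (z , _ , z∈B)) = ⊥-elim (true≢false z∈B (ball-0 {x} {z}))

  ball-pred : ∀ {x k y} → Ball x (suc k) y ≡ true → Ball x k y ≡ false → y ≢ x →
              ∃ λ z → y ~ z ≡ true × Ball x k z ≡ true
  ball-pred {x} {k} {y} e y∉B y≢x with ball-suc⁻ {x} {k} {y} e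
  ... | inj₁ y≡x        = ⊥-elim (y≢x y≡x)
  ... | inj₂ (inj₁ y∈B) = ⊥-elim (true≢false y∈B y∉B)
  ... | inj₂ (inj₂ y~B) = y~B

  ball-shift : ∀ {u v} → v ~ u ≡ true → ∀ k {y} → Ball u k y ≡ true → Ball v (suc k) y ≡ true
  ball-shift {u} {v} v~u zero {y} e = ⊥-elim (true≢false e (ball-0 {u} {y}))
  ball-shift {u} {v} v~u (suc k) {y} e with ball-suc⁻ {u} {k} {y} e
  ... | inj₁ refl                   = ball-adj {v} {suc k} {u} (~-sym v~u) (ball-centre v k)
  ... | inj₂ (inj₁ y∈B)             = ball-suc {v} {suc k} {y} (ball-shift v~u k y∈B)
  ... | inj₂ (inj₂ (z , y~z , z∈B)) = ball-adj {v} {suc k} {y} y~z (ball-shift v~u k z∈B)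

  ball-first-step : ∀ {v} j {z} → Ball v (suc j) z ≡ true → z ≢ v →
                    ∃ λ u → v ~ u ≡ true × Ball u j z ≡ true
  ball-first-step zero e z≢v = ⊥-elim (z≢v (ball-1 e))
  ball-first-step {v} (suc j) {z} e z≢v with ball-suc⁻ {v} {suc j} {z} e
  ... | inj₁ z≡v = ⊥-elim (z≢v z≡v)
  ... | inj₂ (inj₁ z∈B) with ball-first-step j z∈B z≢v
  ...   | u , v~u , z∈Bu = u , v~u , ball-suc {u} {j} {z} z∈Bu
  ball-first-step {v} (suc j) {z} e z≢v | inj₂ (inj₂ (w , z~w , w∈B)) = through (w ≟ v)
    where
    through : Dec (w ≡ v) → ∃ λ u → v ~ u ≡ true × Ball u (suc j) z ≡ true
    through (yes refl) = z , ~-sym z~w , ball-centre z j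
    through (no w≢v) with ball-first-step j w∈B w≢v
    ... | u , v~u , w∈Bu = u , v~u , ball-adj {u} {j} {z} z~w w∈Bu

  ball-walk : ∀ {x a b k} j → Ball x (suc j) a ≡ true → Walk G a b k → Ball x (suc (j + k)) b ≡ true
  ball-walk {x} j e nil rewrite +-identityʳ j = e
  ball-walk {x} {k = suc k} j e (cons a~w w) rewrite +-suc j k =
    ball-walk (suc j) (ball-adj {x} {suc j} (~-sym (Equivalence.to T-≡ a~w)) e) w

  Sphere : Fin n → ℕ → Fin n → Bool
  Sphere x k y = Ball x (suc k) y ∧ not (Ball x k y)

  sphere-intro : ∀ {x k y} → Ball x (suc k) y ≡ true → Ball x k y ≡ false → Sphere x k y ≡ true
  sphere-intro y∈B y∉B = ∧-intro y∈B (false⇒not-true y∉B)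

  sphere⇒ball : ∀ {x k y} → Sphere x k y ≡ true → Ball x (suc k) y ≡ true
  sphere⇒ball e = proj₁ (∧-elim e)

  sphere⇒¬ball : ∀ {x k y} → Sphere x k y ≡ true → Ball x k y ≡ false
  sphere⇒¬ball {x} {k} {y} e = not-true⇒false (proj₂ (∧-elim {Ball x (suc k) y} e))

  ball⇒¬sphere : ∀ {x k y} → Ball x k y ≡ true → Sphere x k y ≡ false
  ball⇒¬sphere y∈B = ≢true⇒false (λ y∈S → true≢false y∈B (sphere⇒¬ball y∈S))

  sphere-0 : ∀ {x y} → Sphere x 0 y ≡ true → y ≡ x
  sphere-0 e = ball-1 (sphere⇒ball e)

  sphere-parent : ∀ {x k y} → Sphere x (suc k) y ≡ true → ∃ λ z → y ~ z ≡ true × Sphere x k z ≡ true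
  sphere-parent {x} {k} {y} e with ball-pred {x} {suc k} {y} (sphere⇒ball e) (sphere⇒¬ball {x} {suc k} e) y≢x
    where
    y≢x : y ≢ x
    y≢x refl = true≢false (ball-centre x k) (sphere⇒¬ball {x} {suc k} e)
  ... | z , y~z , z∈B with bool-cases (Ball x k z)
  ...   | inj₁ z∈B′ = ⊥-elim (true≢false (ball-adj {x} {k} {y} y~z z∈B′) (sphere⇒¬ball {x} {suc k} e))
  ...   | inj₂ z∉B′ = z , y~z , sphere-intro {x} {k} {z} z∈B z∉B′

  neighboursIn : Fin n → (Fin n → Bool) → ℕ
  neighboursIn y S = countIn allF (λ z → y ~ z ∧ S z)

  neighboursIn-none : ∀ y {S} → (∀ z → y ~ z ≡ true → S z ≡ false) → neighboursIn y S ≡ 0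
  neighboursIn-none y {S} none = countIn-none allF pointwise
    where
    pointwise : ∀ z → z ∈ allF → (y ~ z ∧ S z) ≡ false
    pointwise z _ with y ~ z in y~z
    ... | true  = none z y~z
    ... | false = refl

  neighboursIn-all : ∀ y {S} → (∀ z → y ~ z ≡ true → S z ≡ true) → neighboursIn y S ≡ degree G y
  neighboursIn-all y {S} all = ∑-cong allF pointwise
    where
    pointwise : ∀ z → indicator (λ z → y ~ z ∧ S z) z ≡ indicator (y ~_) z
    pointwise z with y ~ z in y~z
    ... | true rewrite all z y~z = refl
    ... | false = refl

  neighboursIn≤1⇒unique : ∀ {y S z z′} → neighboursIn y S ≤ 1 →
                          y ~ z ≡ true → S z ≡ true → y ~ z′ ≡ true → S z′ ≡ true → z ≡ z′
  neighboursIn≤1⇒unique {y} {S} {z} {z′} c≤1 y~z Sz y~z′ Sz′ =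
    countIn≤1⇒unique (λ w → y ~ w ∧ S w) c≤1 (∈-allFin z) (∈-allFin z′) (∧-intro y~z Sz) (∧-intro y~z′ Sz′)

  unique⇒neighboursIn≤1 : ∀ {y S} →
                          (∀ z z′ → y ~ z ≡ true → S z ≡ true → y ~ z′ ≡ true → S z′ ≡ true → z ≡ z′) →
                          neighboursIn y S ≤ 1
  unique⇒neighboursIn≤1 {y} {S} uniq = unique⇒countIn≤1 (allFin⁺ n) (λ w → y ~ w ∧ S w) pairwise
    where
    pairwise : ∀ z z′ → (y ~ z ∧ S z) ≡ true → (y ~ z′ ∧ S z′) ≡ true → z ≡ z′
    pairwise z z′ e e′ with ∧-elim {y ~ z} e | ∧-elim {y ~ z′} e′
    ... | y~z , Sz | y~z′ , Sz′ = uniq z z′ y~z Sz y~z′ Sz′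

  edges : (Fin n → Bool) → (Fin n → Bool) → ℕ
  edges S T = ∑ allF (λ y → if S y then neighboursIn y T else 0)

  edges-sym : ∀ S T → edges S T ≡ edges T S
  edges-sym S T = begin
    edges S T                                      ≡⟨ ∑-cong allF (λ y → as-double-sum S T y) ⟩
    ∑ allF (λ y → ∑ allF (edgeIndicator S T y))    ≡⟨ ∑-comm allF allF (edgeIndicator S T) ⟩
    ∑ allF (λ z → ∑ allF (λ y → edgeIndicator S T y z))
      ≡⟨ ∑-cong allF (λ z → ∑-cong allF (λ y → edgeIndicator-sym S T y z)) ⟩
    ∑ allF (λ z → ∑ allF (edgeIndicator T S z))    ≡⟨ ∑-cong allF (λ z → as-double-sum T S z) ⟨
    edges T S                                      ∎
    where
    open ≡-Reasoning
    edgeIndicator : (Fin n → Bool) → (Fin n → Bool) → Fin n → Fin n → ℕ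
    edgeIndicator S T y z = if S y ∧ (y ~ z ∧ T z) then 1 else 0

    as-double-sum : ∀ S T y → (if S y then neighboursIn y T else 0) ≡ ∑ allF (edgeIndicator S T y)
    as-double-sum S T y with S y
    ... | true  = refl
    ... | false = sym (∑-zero allF)

    edgeIndicator-sym : ∀ S T y z → edgeIndicator S T y z ≡ edgeIndicator T S z y
    edgeIndicator-sym S T y z rewrite SimpleGraph.sym G y z with S y | T z | z ~ y
    ... | true  | true  | b = refl
    ... | true  | false | b = cong (λ c → if c then 1 else 0) (∧-zeroʳ b)
    ... | false | true  | b = cong (λ c → if c then 1 else 0) (sym (∧-zeroʳ b))
    ... | false | false | b = refl

  sphereSize : Fin n → ℕ → ℕ
  sphereSize x k = countIn allF (Sphere x k)

  downEdges : Fin n → ℕ → ℕ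
  downEdges x k = edges (Sphere x k) (Ball x k)

  sphereSize-0 : ∀ x → sphereSize x 0 ≤ 1
  sphereSize-0 x = unique⇒countIn≤1 (allFin⁺ n) (Sphere x 0)
                     (λ z z′ e e′ → trans (sphere-0 e) (sym (sphere-0 e′)))

  downEdges-0 : ∀ x → downEdges x 0 ≡ 0
  downEdges-0 x = trans (∑-cong allF pointwise) (∑-zero allF)
    where
    pointwise : ∀ z → (if Sphere x 0 z then neighboursIn z (Ball x 0) else 0) ≡ 0
    pointwise z with Sphere x 0 z
    ... | false = refl
    ... | true  = neighboursIn-none z (λ w _ → ball-0 {x} {w})

  hasParent : ∀ x k z → Sphere x (suc k) z ≡ true → 1 ≤ neighboursIn z (Ball x (suc k))
  hasParent x k z z∈S with sphere-parent {x} {k} {z} z∈S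
  ... | w , z~w , w∈S = countIn-member {l = allF} (λ u → z ~ u ∧ Ball x (suc k) u) (∈-allFin w)
                          (∧-intro z~w (sphere⇒ball {x} {k} {w} w∈S))

  indicator≤parents : ∀ x k z →
    indicator (Sphere x (suc k)) z ≤ (if Sphere x (suc k) z then neighboursIn z (Ball x (suc k)) else 0)
  indicator≤parents x k z with Sphere x (suc k) z in z∈S
  ... | true  = hasParent x k z z∈S
  ... | false = z≤n

  sphereSize≤downEdges : ∀ x k → sphereSize x (suc k) ≤ downEdges x (suc k)
  sphereSize≤downEdges x k = ∑-mono-≤ allF (indicator≤parents x k)

  downEdges≤sphereSize⇒uniqueParent : ∀ x k → downEdges x (suc k) ≤ sphereSize x (suc k) →
    ∀ y → Sphere x (suc k) y ≡ true → neighboursIn y (Ball x (suc k)) ≤ 1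
  downEdges≤sphereSize⇒uniqueParent x k d≤s y y∈S with neighboursIn y (Ball x (suc k)) ≤? 1
  ... | yes c≤1 = c≤1
  ... | no  c≰1 = ⊥-elim (<⇒≱ (∑-mono-< allF (∈-allFin y) (indicator≤parents x k) at-y) d≤s)
    where
    at-y : indicator (Sphere x (suc k)) y < (if Sphere x (suc k) y then neighboursIn y (Ball x (suc k)) else 0)
    at-y rewrite y∈S = ≰⇒> c≰1

  uniqueParent⇒downEdges≤sphereSize : ∀ x k →
    (∀ y → Sphere x k y ≡ true → neighboursIn y (Ball x k) ≤ 1) → downEdges x k ≤ sphereSize x k
  uniqueParent⇒downEdges≤sphereSize x k unique = ∑-mono-≤ allF pointwise
    where
    pointwise : ∀ z → (if Sphere x k z then neighboursIn z (Ball x k) else 0) ≤ indicator (Sphere x k) z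
    pointwise z with Sphere x k z in z∈S
    ... | true  = unique z z∈S
    ... | false = z≤n

  layerEdges : Fin n → ℕ → Fin n → ℕ
  layerEdges x k z = (if Ball x (suc k) z then neighboursIn z (Sphere x (suc k)) else 0)
                   + (if Sphere x k z then neighboursIn z (Ball x k) else 0)

  ∑-layerEdges : ∀ x k → ∑ allF (layerEdges x k) ≡ downEdges x (suc k) + downEdges x k
  ∑-layerEdges x k = trans (∑-distrib-+ allF _ _)
                       (cong (_+ downEdges x k) (edges-sym (Ball x (suc k)) (Sphere x (suc k))))

  layerEdges-off-sphere : ∀ x k z → Sphere x k z ≡ false → layerEdges x k z ≡ 0
  layerEdges-off-sphere x k z z∉S = cong₂ _+_ no-up-edges (if-cong z∉S)
    where
    no-up-edges : (if Ball x (suc k) z then neighboursIn z (Sphere x (suc k)) else 0) ≡ 0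
    no-up-edges with Ball x (suc k) z in z∈B′ | Ball x k z in z∈B
    ... | false | _     = refl
    ... | true  | false = ⊥-elim (true≢false refl z∉S)
    ... | true  | true  = neighboursIn-none z λ w z~w →
                            ball⇒¬sphere {x} {suc k} {w} (ball-adj {x} {k} {w} (~-sym z~w) z∈B)

  layerEdges-on-sphere : ∀ x k z → Sphere x k z ≡ true →
    layerEdges x k z ≡ neighboursIn z (Sphere x (suc k)) + neighboursIn z (Ball x k)
  layerEdges-on-sphere x k z z∈S = cong₂ _+_ (if-cong (sphere⇒ball {x} {k} {z} z∈S)) (if-cong z∈S)

  layerEdges≤degree : ∀ x k z → Sphere x k z ≡ true → layerEdges x k z ≤ degree G z
  layerEdges≤degree x k z z∈S = subst (_≤ degree G z) (sym (layerEdges-on-sphere x k z z∈S))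
    (countIn-disjoint allF {p = z ~_} (λ w e → proj₁ (∧-elim e)) (λ w e → proj₁ (∧-elim e)) disjoint)
    where
    disjoint : ∀ w → (z ~ w ∧ Sphere x (suc k) w) ≡ true → (z ~ w ∧ Ball x k w) ≡ true → ⊥
    disjoint w up down = true≢false (ball-suc {x} {k} {w} (proj₂ (∧-elim {z ~ w} down)))
                                    (sphere⇒¬ball {x} {suc k} {w} (proj₂ (∧-elim {z ~ w} up)))

  degree≤layerEdges : ∀ x k z → (∀ u w → Sphere x k u ≡ true → Sphere x k w ≡ true → u ~ w ≡ true → ⊥) →
                      Sphere x k z ≡ true → degree G z ≤ layerEdges x k z
  degree≤layerEdges x k z independent z∈S = subst (degree G z ≤_) (sym (layerEdges-on-sphere x k z z∈S))
    (countIn-∨ allF {p = z ~_} up-or-down)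
    where
    up-or-down : ∀ w → z ~ w ≡ true → ((z ~ w ∧ Sphere x (suc k) w) ∨ (z ~ w ∧ Ball x k w)) ≡ true
    up-or-down w z~w with bool-cases (Ball x k w) | bool-cases (Ball x (suc k) w)
    ... | inj₁ w∈B | _       = ∨-introʳ {z ~ w ∧ Sphere x (suc k) w} (∧-intro z~w w∈B)
    ... | inj₂ w∈B | inj₁ w∈B′ = ⊥-elim (independent z w z∈S (sphere-intro {x} {k} {w} w∈B′ w∈B) z~w)
    ... | inj₂ w∈B | inj₂ w∈B′ = ∨-introˡ (∧-intro z~w (sphere-intro {x} {suc k} {w}
                            (ball-adj {x} {suc k} {w} (~-sym z~w) (sphere⇒ball {x} {k} {z} z∈S)) w∈B′))

  d*[z∈S]≡d : ∀ {S : Fin n → Bool} {z d} → S z ≡ true → d * indicator S z ≡ d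
  d*[z∈S]≡d {d = d} z∈S = trans (cong (d *_) (if-cong z∈S)) (*-identityʳ d)

  d*[z∉S]≡0 : ∀ {S : Fin n → Bool} {z d} → S z ≡ false → d * indicator S z ≡ 0
  d*[z∉S]≡0 {d = d} z∉S = trans (cong (d *_) (if-cong z∉S)) (*-zeroʳ d)

  up+downEdges≤degree*sphereSize : ∀ x k d → (∀ z → Sphere x k z ≡ true → degree G z ≡ d) →
                                   downEdges x (suc k) + downEdges x k ≤ d * sphereSize x k
  up+downEdges≤degree*sphereSize x k d degree≡d =
    subst₂ _≤_ (∑-layerEdges x k) (∑-distribˡ-* allF d (indicator (Sphere x k))) (∑-mono-≤ allF pointwise)
    where
    pointwise : ∀ z → layerEdges x k z ≤ d * indicator (Sphere x k) z
    pointwise z with bool-cases (Sphere x k z)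
    ... | inj₁ z∈S = ≤-trans (layerEdges≤degree x k z z∈S) (≤-reflexive (trans (degree≡d z z∈S) (sym (d*[z∈S]≡d {Sphere x k} {z} {d} z∈S))))
    ... | inj₂ z∉S = ≤-reflexive (trans (layerEdges-off-sphere x k z z∉S) (sym (d*[z∉S]≡0 {Sphere x k} {z} {d} z∉S)))

  degree*sphereSize≤up+downEdges : ∀ x k d → (∀ z → Sphere x k z ≡ true → degree G z ≡ d) →
    (∀ u w → Sphere x k u ≡ true → Sphere x k w ≡ true → u ~ w ≡ true → ⊥) →
    d * sphereSize x k ≤ downEdges x (suc k) + downEdges x k
  degree*sphereSize≤up+downEdges x k d degree≡d independent =
    subst₂ _≤_ (∑-distribˡ-* allF d (indicator (Sphere x k))) (∑-layerEdges x k) (∑-mono-≤ allF pointwise)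
    where
    pointwise : ∀ z → d * indicator (Sphere x k) z ≤ layerEdges x k z
    pointwise z with bool-cases (Sphere x k z)
    ... | inj₁ z∈S = subst (_≤ layerEdges x k z) (trans (degree≡d z z∈S) (sym (d*[z∈S]≡d {Sphere x k} {z} {d} z∈S)))
                        (degree≤layerEdges x k z independent z∈S)
    ... | inj₂ z∉S = ≤-reflexive (trans (d*[z∉S]≡0 {Sphere x k} {z} {d} z∉S) (sym (layerEdges-off-sphere x k z z∉S)))

-- Biregular bipartite graphs

alternate : Bool → ℕ → Bool
alternate b zero    = b
alternate b (suc k) = not (alternate b k)

double : ℕ → ℕ
double zero    = zero
double (suc i) = suc (suc (double i))

alternate-double : ∀ b i → alternate b (double i) ≡ b
alternate-double b zero    = refl
alternate-double b (suc i) rewrite alternate-double b i = not-involutive b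

double-mono-≤ : ∀ {i m} → i ≤ m → double i ≤ double m
double-mono-≤ {zero}  _         = z≤n
double-mono-≤ {suc i} (s≤s i≤m) = s≤s (s≤s (double-mono-≤ i≤m))

double-mono-< : ∀ {i m} → i < m → suc (double i) ≤ double m
double-mono-< i<m = ≤-trans (n≤1+n _) (double-mono-≤ i<m)

module BiregularBipartiteGraph {n r s : ℕ} (G : SimpleGraph n) (B : BiregularBipartite n r s G) where

  open Balls G public

  inV₂ : Fin n → Bool
  inV₂ y = not (side B y)

  side-adjacent : ∀ {u v} → u ~ v ≡ true → side B v ≡ not (side B u)
  side-adjacent {u} {v} u~v = ¬-not λ e → stable B u v (≡true⇒T u~v) (sym e)

  side-sphere : ∀ x k y → Sphere x k y ≡ true → side B y ≡ alternate (side B x) k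
  side-sphere x zero    y y∈S with sphere-0 y∈S
  ... | refl = refl
  side-sphere x (suc k) y y∈S with sphere-parent {x} {k} {y} y∈S
  ... | z , y~z , z∈S = trans (side-adjacent (~-sym y~z)) (cong not (side-sphere x k z z∈S))

  sphere-independent : ∀ x k u w → Sphere x k u ≡ true → Sphere x k w ≡ true → u ~ w ≡ true → ⊥
  sphere-independent x k u w u∈S w∈S u~w =
    stable B u w (≡true⇒T u~w) (trans (side-sphere x k u u∈S) (sym (side-sphere x k w w∈S)))

  sphere-degree : ∀ x k b → alternate (side B x) k ≡ b →
                  ∀ z → Sphere x k z ≡ true → degree G z ≡ (if b then r else s)
  sphere-degree x k true  alt≡b z z∈S = degV₁ B z (trans (side-sphere x k z z∈S) alt≡b)
  sphere-degree x k false alt≡b z z∈S = degV₂ B z (trans (side-sphere x k z z∈S) alt≡b)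

  even-side : ∀ {x} b → side B x ≡ b → ∀ i → alternate (side B x) (double i) ≡ b
  even-side b x∈ i = trans (alternate-double _ i) x∈

  odd-side : ∀ {x} b → side B x ≡ b → ∀ i → alternate (side B x) (suc (double i)) ≡ not b
  odd-side b x∈ i = cong not (even-side b x∈ i)

  |V₁| |V₂| : ℕ
  |V₁| = countIn allF (side B)
  |V₂| = countIn allF inV₂

  order≡|V₁|+|V₂| : n ≡ |V₁| + |V₂|
  order≡|V₁|+|V₂| = sym (trans (countIn-+-not allF (side B)) (length-tabulate {n = n} (λ x → x)))

  r*|V₁|≡s*|V₂| : r * |V₁| ≡ s * |V₂|
  r*|V₁|≡s*|V₂| = begin
    r * |V₁|         ≡⟨ ∑-if-const allF (side B) (λ y → neighboursIn y inV₂) r from-V₁ ⟨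
    edges (side B) inV₂ ≡⟨ edges-sym (side B) inV₂ ⟩
    edges inV₂ (side B) ≡⟨ ∑-if-const allF inV₂ (λ y → neighboursIn y (side B)) s from-V₂ ⟩
    s * |V₂|         ∎
    where
    open ≡-Reasoning
    from-V₁ : ∀ y → side B y ≡ true → neighboursIn y inV₂ ≡ r
    from-V₁ y y∈V₁ = trans (neighboursIn-all y λ z y~z → false⇒not-true (trans (side-adjacent y~z) (cong not y∈V₁)))
                           (degV₁ B y y∈V₁)
    from-V₂ : ∀ y → inV₂ y ≡ true → neighboursIn y (side B) ≡ s
    from-V₂ y y∈V₂ = trans (neighboursIn-all y λ z y~z → trans (side-adjacent y~z) (cong not (not-true⇒false y∈V₂)))
                           (degV₂ B y (not-true⇒false y∈V₂))

  q : ℕ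
  q = (r ∸ 1) * (s ∸ 1)

  excess : Fin n → ℕ → ℕ
  excess u k = downEdges u k ∸ sphereSize u k

  totalExcess : Fin n → ℕ → ℕ
  totalExcess u = prefixSum (excess u)

  sphereSize+excess≡downEdges : ∀ u k → sphereSize u (suc k) + excess u (suc k) ≡ downEdges u (suc k)
  sphereSize+excess≡downEdges u k = m+[n∸m]≡n (sphereSize≤downEdges u k)

  v₂InBall : Fin n → ℕ → ℕ
  v₂InBall u i = countIn allF (λ y → Ball u (suc (double i)) y ∧ inV₂ y)

  v₂InBall-0 : ∀ u → v₂InBall u 0 ≤ 1
  v₂InBall-0 u = unique⇒countIn≤1 (allFin⁺ n) _ λ z z′ e e′ →
    trans (ball-1 (proj₁ (∧-elim e))) (sym (ball-1 (proj₁ (∧-elim e′))))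

  v₂InBall-suc : ∀ u → side B u ≡ false → ∀ i → v₂InBall u (suc i) ≤ v₂InBall u i + sphereSize u (double (suc i))
  v₂InBall-suc u u∈V₂ i = countIn-∨ allF old-or-new
    where
    old-or-new : ∀ y → (Ball u (suc (double (suc i))) y ∧ inV₂ y) ≡ true →
                 ((Ball u (suc (double i)) y ∧ inV₂ y) ∨ Sphere u (double (suc i)) y) ≡ true
    old-or-new y e with ∧-elim e
    ... | y∈B , y∈V₂ with bool-cases (Ball u (suc (double i)) y) | bool-cases (Ball u (suc (suc (double i))) y)
    ...   | inj₁ y∈B₁ | _         = ∨-introˡ (∧-intro y∈B₁ y∈V₂)
    ...   | inj₂ y∉B₁ | inj₂ y∉B₂ = ∨-introʳ {Ball u (suc (double i)) y ∧ inV₂ y} (sphere-intro {u} {suc (suc (double i))} {y} y∈B y∉B₂)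
    ...   | inj₂ y∉B₁ | inj₁ y∈B₂ = ⊥-elim (true≢false y∈V₂ (cong not odd))
      where
      odd : side B y ≡ true
      odd = trans (side-sphere u (suc (double i)) y (sphere-intro {u} {suc (double i)} {y} y∈B₂ y∉B₁)) (odd-side false u∈V₂ i)

  module AroundV₂ (u : Fin n) (u∈V₂ : side B u ≡ false) (2≤r : 2 ≤ r) (2≤s : 2 ≤ s) where

    up+down≤ : ∀ k b → alternate (side B u) k ≡ b → ∀ d → (if b then r else s) ≡ d →
               downEdges u (suc k) + downEdges u k ≤ d * sphereSize u k
    up+down≤ k b alt≡b d deg≡d = up+downEdges≤degree*sphereSize u k d λ z z∈S → trans (sphere-degree u k b alt≡b z z∈S) deg≡d

    r≡suc[r∸1] : r ≡ suc (r ∸ 1)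
    r≡suc[r∸1] = sym (suc-pred r {{>-nonZero (≤-trans (s≤s z≤n) 2≤r)}})

    s≡suc[s∸1] : s ≡ suc (s ∸ 1)
    s≡suc[s∸1] = sym (suc-pred s {{>-nonZero (≤-trans (s≤s z≤n) 2≤s)}})

    moore-upper-bound : ∀ i → (downEdges u (suc (double i)) + totalExcess u (double i) ≤ s * q ^ i)
                            × (v₂InBall u i + totalExcess u (double i) ≤ 1 + s * (r ∸ 1) * geomSum q i)
    moore-upper-bound zero = edges-bound , ball-bound
      where
      open ≤-Reasoning
      edges-bound : downEdges u 1 + 0 ≤ s * 1
      edges-bound = begin
        downEdges u 1 + 0            ≡⟨ cong (downEdges u 1 +_) (downEdges-0 u) ⟨
        downEdges u 1 + downEdges u 0 ≤⟨ up+down≤ 0 false u∈V₂ s refl ⟩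
        s * sphereSize u 0           ≤⟨ *-monoʳ-≤ s (sphereSize-0 u) ⟩
        s * 1                        ∎
      ball-bound : v₂InBall u 0 + 0 ≤ 1 + s * (r ∸ 1) * 0
      ball-bound = ≤-trans (≤-reflexive (+-identityʳ _)) (≤-trans (v₂InBall-0 u) (m≤m+n 1 _))
    moore-upper-bound (suc i) with moore-upper-bound i
    ... | edges-i , ball-i = edges-bound , ball-bound
      where
      j₁ j₂ : ℕ
      j₁ = suc (double i)
      j₂ = suc j₁
      odd-layer : downEdges u j₂ + totalExcess u j₁ ≤ (r ∸ 1) * (s * q ^ i)
      odd-layer = proj₁ $ moore-step (r ∸ 1) (downEdges u (suc j₁)) (downEdges u j₁) (sphereSize u j₁) (excess u j₁)
                    (totalExcess u (double i)) (s * q ^ i) (∸-monoˡ-≤ 1 2≤r)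
                    (up+down≤ j₁ true (odd-side false u∈V₂ i) (suc (r ∸ 1)) r≡suc[r∸1])
                    (sphereSize+excess≡downEdges u (double i)) edges-i
      even-layer : (downEdges u (suc j₂) + totalExcess u j₂ ≤ (s ∸ 1) * ((r ∸ 1) * (s * q ^ i)))
                 × (sphereSize u j₂ + totalExcess u j₂ ≤ (r ∸ 1) * (s * q ^ i))
      even-layer = moore-step (s ∸ 1) (downEdges u (suc j₂)) (downEdges u j₂) (sphereSize u j₂) (excess u j₂)
                     (totalExcess u j₁) ((r ∸ 1) * (s * q ^ i)) (∸-monoˡ-≤ 1 2≤s)
                     (up+down≤ j₂ false (even-side false u∈V₂ (suc i)) (suc (s ∸ 1)) s≡suc[s∸1])
                     (sphereSize+excess≡downEdges u j₁) odd-layer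
      regroup : ∀ r′ s′ s Q → s′ * (r′ * (s * Q)) ≡ s * (r′ * s′ * Q)
      regroup = solve-∀
      edges-bound : downEdges u (suc j₂) + totalExcess u j₂ ≤ s * q ^ suc i
      edges-bound = subst (downEdges u (suc j₂) + totalExcess u j₂ ≤_) (regroup (r ∸ 1) (s ∸ 1) s (q ^ i)) (proj₁ even-layer)
      geometric : ∀ s r′ Q X → 1 + s * r′ * X + r′ * (s * Q) ≡ 1 + s * r′ * (Q + X)
      geometric = solve-∀
      ball-bound : v₂InBall u (suc i) + totalExcess u j₂ ≤ 1 + s * (r ∸ 1) * geomSum q (suc i)
      ball-bound = begin
        v₂InBall u (suc i) + totalExcess u j₂
          ≤⟨ +-monoˡ-≤ (totalExcess u j₂) (v₂InBall-suc u u∈V₂ i) ⟩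
        v₂InBall u i + sphereSize u j₂ + totalExcess u j₂
          ≡⟨ +-assoc (v₂InBall u i) _ _ ⟩
        v₂InBall u i + (sphereSize u j₂ + totalExcess u j₂)
          ≤⟨ +-monoˡ-≤ _ (m≤m+n (v₂InBall u i) (totalExcess u (double i))) ⟩
        v₂InBall u i + totalExcess u (double i) + (sphereSize u j₂ + totalExcess u j₂)
          ≤⟨ +-mono-≤ ball-i (proj₂ even-layer) ⟩
        1 + s * (r ∸ 1) * geomSum q i + (r ∸ 1) * (s * q ^ i)
          ≡⟨ geometric s (r ∸ 1) (q ^ i) (geomSum q i) ⟩
        1 + s * (r ∸ 1) * geomSum q (suc i) ∎
        where open ≤-Reasoning

  V₂-witness : 1 ≤ |V₂| → ∃ λ u → side B u ≡ false
  V₂-witness 1≤|V₂| with countIn-witness allF inV₂ 1≤|V₂|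
  ... | u , u∈V₂ = u , not-true⇒false u∈V₂

  V₁-neighbour : 1 ≤ s → ∀ u → side B u ≡ false → ∃ λ v → u ~ v ≡ true × side B v ≡ true
  V₁-neighbour 1≤s u u∈V₂ with countIn-witness allF (u ~_) (subst (1 ≤_) (sym (degV₂ B u u∈V₂)) 1≤s)
  ... | v , u~v = v , u~v , trans (side-adjacent u~v) (cong not u∈V₂)

  |V₂|≤v₂InBall : ∀ u m → side B u ≡ false → (∀ y → Σ ℕ λ k → k ≤ suc (double m) × Walk G u y k) →
                  |V₂| ≤ v₂InBall u m
  |V₂|≤v₂InBall u m u∈V₂ reach = countIn-mono allF covered
    where
    covered : ∀ y → inV₂ y ≡ true → (Ball u (suc (double m)) y ∧ inV₂ y) ≡ true
    covered y y∈V₂ with reach y | bool-cases (Ball u (suc (double m)) y)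
    ... | _ , _ , _ | inj₁ y∈B = ∧-intro y∈B y∈V₂
    ... | k , k≤ , walk | inj₂ y∉B = ⊥-elim (true≢false y∈V₂ (cong not odd))
      where
      y∈B′ : Ball u (suc (suc (double m))) y ≡ true
      y∈B′ = ball-mono {u} {suc k} {suc (suc (double m))} {y} (s≤s k≤) (ball-walk 0 (ball-centre u 0) walk)
      odd : side B y ≡ true
      odd = trans (side-sphere u (suc (double m)) y (sphere-intro {u} {suc (double m)} {y} y∈B′ y∉B))
                  (odd-side false u∈V₂ m)

  UniqueParents : Fin n → ℕ → Set
  UniqueParents x J = ∀ j → 1 ≤ j → j ≤ J → ∀ y → Sphere x j y ≡ true → neighboursIn y (Ball x j) ≤ 1

  totalExcess≡0⇒uniqueParents : ∀ u J → totalExcess u J ≡ 0 → UniqueParents u J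
  totalExcess≡0⇒uniqueParents u J total≡0 (suc k) _ k<J =
    downEdges≤sphereSize⇒uniqueParent u k (≤-reflexive (begin
      downEdges u (suc k)                          ≡⟨ sphereSize+excess≡downEdges u k ⟨
      sphereSize u (suc k) + excess u (suc k)      ≡⟨ cong (sphereSize u (suc k) +_) excess≡0 ⟩
      sphereSize u (suc k) + 0                     ≡⟨ +-identityʳ _ ⟩
      sphereSize u (suc k)                         ∎))
    where
    open ≡-Reasoning
    excess≡0 : excess u (suc k) ≡ 0
    excess≡0 = prefixSum≡0 (excess u) J total≡0 (suc k) (s≤s z≤n) k<J

  -- Let z₁, z₂ be parents of y ∈ Sphere v (k+1), and let u be the first step of a geodesic from v to z₁.
  -- Then y ∈ Sphere u k, so z₂ is a parent of y around u as well (and z₁ = z₂), or z₂ ∈ Sphere u (k+1)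
  -- has the two parents y and (via u) its own parent around v, which forces y ∈ Ball v k.
  uniqueParents-from-neighbours : ∀ v J → (∀ u → v ~ u ≡ true → UniqueParents u J) → UniqueParents v J
  uniqueParents-from-neighbours v J around-u (suc zero) _ _ y y∈S =
    unique⇒neighboursIn≤1 λ z z′ _ z∈B _ z′∈B → trans (ball-1 z∈B) (sym (ball-1 z′∈B))
  uniqueParents-from-neighbours v J around-u (suc (suc k′)) _ k+1≤J y y∈S = unique⇒neighboursIn≤1 uniq
    where
    k : ℕ
    k = suc k′
    y∉B : Ball v (suc k) y ≡ false
    y∉B = sphere⇒¬ball {v} {suc k} {y} y∈S
    parent∉B : ∀ z → y ~ z ≡ true → Ball v k z ≡ false
    parent∉B z y~z = ≢true⇒false λ z∈B → true≢false (ball-adj {v} {k} {y} y~z z∈B) y∉B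
    parent≢v : ∀ z → y ~ z ≡ true → z ≢ v
    parent≢v z y~z refl = true≢false (ball-centre v k′) (parent∉B z y~z)
    uniq : ∀ z₁ z₂ → y ~ z₁ ≡ true → Ball v (suc k) z₁ ≡ true → y ~ z₂ ≡ true → Ball v (suc k) z₂ ≡ true → z₁ ≡ z₂
    uniq z₁ z₂ y~z₁ z₁∈B y~z₂ z₂∈B with ball-first-step {v} k {z₁} z₁∈B (parent≢v z₁ y~z₁)
    ... | u , v~u , z₁∈Bu = second-parent (bool-cases (Ball u k z₂)) (bool-cases (Ball u (suc k) z₂))
      where
      unique-u : UniqueParents u J
      unique-u = around-u u v~u
      y∈Bu : Ball u (suc k) y ≡ true
      y∈Bu = ball-adj {u} {k} {y} y~z₁ z₁∈Bu
      y∈Su : Sphere u k y ≡ true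
      y∈Su = sphere-intro {u} {k} {y} y∈Bu (≢true⇒false λ y∈Bu′ → true≢false (ball-shift v~u k y∈Bu′) y∉B)
      second-parent : Ball u k z₂ ≡ true ⊎ Ball u k z₂ ≡ false →
                      Ball u (suc k) z₂ ≡ true ⊎ Ball u (suc k) z₂ ≡ false → z₁ ≡ z₂
      second-parent (inj₁ z₂∈Bu) _ =
        neighboursIn≤1⇒unique (unique-u k (s≤s z≤n) (≤-trans (n≤1+n k) k+1≤J) y y∈Su) y~z₁ z₁∈Bu y~z₂ z₂∈Bu
      second-parent (inj₂ z₂∉Bu) (inj₁ z₂∈Bu′) =
        ⊥-elim (sphere-independent u k y z₂ y∈Su (sphere-intro {u} {k} {z₂} z₂∈Bu′ z₂∉Bu) y~z₂)
      second-parent (inj₂ _) (inj₂ z₂∉Bu′)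
        with ball-pred {v} {k} {z₂} z₂∈B (parent∉B z₂ y~z₂) (parent≢v z₂ y~z₂)
      ... | w , z₂~w , w∈B = ⊥-elim (true≢false (ball-suc {v} {k} {y} (subst (λ t → Ball v k t ≡ true) (sym y≡w) w∈B)) y∉B)
        where
        z₂∈Su : Sphere u (suc k) z₂ ≡ true
        z₂∈Su = sphere-intro {u} {suc k} {z₂} (ball-adj {u} {suc k} {z₂} (~-sym y~z₂) y∈Bu) z₂∉Bu′
        y≡w : y ≡ w
        y≡w = neighboursIn≤1⇒unique (unique-u (suc k) (s≤s z≤n) k+1≤J z₂ z₂∈Su)
                (~-sym y~z₂) y∈Bu z₂~w (ball-shift (~-sym v~u) k w∈B)

  v₁InBall : Fin n → ℕ → ℕ
  v₁InBall v i = countIn allF (λ y → Ball v (suc (double i)) y ∧ side B y)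

  v₁InBall-suc : ∀ v → side B v ≡ true → ∀ i → v₁InBall v i + sphereSize v (double (suc i)) ≤ v₁InBall v (suc i)
  v₁InBall-suc v v∈V₁ i = countIn-disjoint allF old new disjoint
    where
    old : ∀ y → (Ball v (suc (double i)) y ∧ side B y) ≡ true → (Ball v (suc (double (suc i))) y ∧ side B y) ≡ true
    old y e with ∧-elim e
    ... | y∈B , y∈V₁ = ∧-intro (ball-mono {v} {suc (double i)} {suc (double (suc i))} {y} (≤-trans (n≤1+n _) (n≤1+n _)) y∈B) y∈V₁
    new : ∀ y → Sphere v (double (suc i)) y ≡ true → (Ball v (suc (double (suc i))) y ∧ side B y) ≡ true
    new y y∈S = ∧-intro (sphere⇒ball {v} {double (suc i)} {y} y∈S)
                        (trans (side-sphere v (double (suc i)) y y∈S) (even-side true v∈V₁ (suc i)))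
    disjoint : ∀ y → (Ball v (suc (double i)) y ∧ side B y) ≡ true → Sphere v (double (suc i)) y ≡ true → ⊥
    disjoint y e y∈S = true≢false (ball-suc {v} {suc (double i)} {y} (proj₁ (∧-elim e)))
                                  (sphere⇒¬ball {v} {double (suc i)} {y} y∈S)

  module AroundV₁ (v : Fin n) (v∈V₁ : side B v ≡ true) (2≤r : 2 ≤ r) (2≤s : 2 ≤ s) (m : ℕ)
                (unique : UniqueParents v (double m)) where

    down≤size : ∀ j → 1 ≤ j → j ≤ double m → downEdges v j ≤ sphereSize v j
    down≤size j 1≤j j≤2m = uniqueParent⇒downEdges≤sphereSize v j (unique j 1≤j j≤2m)

    degree*size≤ : ∀ k b → alternate (side B v) k ≡ b → ∀ d → (if b then r else s) ≡ d →
                   d * sphereSize v k ≤ downEdges v (suc k) + downEdges v k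
    degree*size≤ k b alt≡b d deg≡d =
      degree*sphereSize≤up+downEdges v k d (λ z z∈S → trans (sphere-degree v k b alt≡b z z∈S) deg≡d)
        (sphere-independent v k)

    growth : ∀ k b → alternate (side B v) k ≡ b → ∀ d → (if b then r else s) ≡ d → 1 ≤ d →
             1 ≤ k → suc k ≤ double m → (d ∸ 1) * sphereSize v k ≤ sphereSize v (suc k)
    growth k b alt≡b d deg≡d 1≤d 1≤k k<2m = d*x≤y+x⇒[d∸1]*x≤y d _ _ 1≤d
      (≤-trans (degree*size≤ k b alt≡b d deg≡d)
               (+-mono-≤ (down≤size (suc k) (s≤s z≤n) k<2m) (down≤size k 1≤k (≤-trans (n≤1+n k) k<2m))))

    moore-lower-bound : ∀ i → i ≤ m → (1 + r * (s ∸ 1) * geomSum q i ≤ v₁InBall v i)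
                                    × (i < m → r * q ^ i ≤ sphereSize v (suc (double i)))
    moore-lower-bound zero _ = ball-bound , sphere-bound
      where
      ball-bound : 1 + r * (s ∸ 1) * 0 ≤ v₁InBall v 0
      ball-bound rewrite *-zeroʳ (r * (s ∸ 1)) =
        countIn-member {l = allF} (λ y → Ball v 1 y ∧ side B y) (∈-allFin v) (∧-intro (ball-centre v 0) v∈V₁)
      sphere-bound : 0 < m → r * 1 ≤ sphereSize v 1
      sphere-bound 0<m = begin
        r * 1                         ≤⟨ *-monoʳ-≤ r v∈S₀ ⟩
        r * sphereSize v 0            ≤⟨ degree*size≤ 0 true v∈V₁ r refl ⟩
        downEdges v 1 + downEdges v 0 ≡⟨ cong (downEdges v 1 +_) (downEdges-0 v) ⟩
        downEdges v 1 + 0             ≡⟨ +-identityʳ _ ⟩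
        downEdges v 1                 ≤⟨ down≤size 1 (s≤s z≤n) (double-mono-< 0<m) ⟩
        sphereSize v 1                ∎
        where
        open ≤-Reasoning
        v∈S₀ : 1 ≤ sphereSize v 0
        v∈S₀ = countIn-member {l = allF} (Sphere v 0) (∈-allFin v) (sphere-intro {v} {0} {v} (ball-centre v 0) (ball-0 {v} {v}))
    moore-lower-bound (suc i) i<m = ball-bound , sphere-bound
      where
      j₁ j₂ : ℕ
      j₁ = suc (double i)
      j₂ = suc j₁
      previous : (1 + r * (s ∸ 1) * geomSum q i ≤ v₁InBall v i) × (i < m → r * q ^ i ≤ sphereSize v j₁)
      previous = moore-lower-bound i (≤-trans (n≤1+n i) i<m)
      size₂ : (s ∸ 1) * (r * q ^ i) ≤ sphereSize v j₂
      size₂ = ≤-trans (*-monoʳ-≤ (s ∸ 1) (proj₂ previous i<m))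
                      (growth j₁ false (odd-side true v∈V₁ i) s refl (≤-trans (s≤s z≤n) 2≤s) (s≤s z≤n) (double-mono-≤ i<m))
      geometric : ∀ r s′ Q X → 1 + r * s′ * X + s′ * (r * Q) ≡ 1 + r * s′ * (Q + X)
      geometric = solve-∀
      ball-bound : 1 + r * (s ∸ 1) * geomSum q (suc i) ≤ v₁InBall v (suc i)
      ball-bound = begin
        1 + r * (s ∸ 1) * geomSum q (suc i)                   ≡⟨ geometric r (s ∸ 1) (q ^ i) (geomSum q i) ⟨
        1 + r * (s ∸ 1) * geomSum q i + (s ∸ 1) * (r * q ^ i) ≤⟨ +-mono-≤ (proj₁ previous) size₂ ⟩
        v₁InBall v i + sphereSize v j₂                        ≤⟨ v₁InBall-suc v v∈V₁ i ⟩
        v₁InBall v (suc i)                                    ∎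
        where open ≤-Reasoning
      regroup : ∀ r r′ s′ Q → r′ * (s′ * (r * Q)) ≡ r * (r′ * s′ * Q)
      regroup = solve-∀
      sphere-bound : suc i < m → r * q ^ suc i ≤ sphereSize v (suc j₂)
      sphere-bound i+1<m = begin
        r * q ^ suc i                      ≡⟨ regroup r (r ∸ 1) (s ∸ 1) (q ^ i) ⟨
        (r ∸ 1) * ((s ∸ 1) * (r * q ^ i))  ≤⟨ *-monoʳ-≤ (r ∸ 1) size₂ ⟩
        (r ∸ 1) * sphereSize v j₂          ≤⟨ growth j₂ true (even-side true v∈V₁ (suc i)) r refl
                                                (≤-trans (s≤s z≤n) 2≤r) (s≤s z≤n) (double-mono-< i+1<m) ⟩
        sphereSize v (suc j₂)              ∎
        where open ≤-Reasoning

  module _ (m : ℕ) (s<r : s < r) (2≤s : 2 ≤ s) (reach : ∀ u y → Σ ℕ λ k → k ≤ suc (double m) × Walk G u y k) where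

    2≤r : 2 ≤ r
    2≤r = ≤-trans 2≤s (<⇒≤ s<r)

    |V₂|+totalExcess≤N₂′ : ∀ u → side B u ≡ false → |V₂| + totalExcess u (double m) ≤ N₂′ r s m
    |V₂|+totalExcess≤N₂′ u u∈V₂ = ≤-trans (+-monoˡ-≤ _ (|V₂|≤v₂InBall u m u∈V₂ (reach u)))
                                          (proj₂ (AroundV₂.moore-upper-bound u u∈V₂ 2≤r 2≤s m))

    N₁≤|V₁| : ∀ v → side B v ≡ true → UniqueParents v (double m) → 1 + r * (s ∸ 1) * geomSum q m ≤ |V₁|
    N₁≤|V₁| v v∈V₁ unique = ≤-trans (proj₁ (AroundV₁.moore-lower-bound v v∈V₁ 2≤r 2≤s m unique m ≤-refl))
                                    (countIn-mono allF λ y e → proj₂ (∧-elim e))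

    N₂′≤|V₂|⇒uniqueParents : N₂′ r s m ≤ |V₂| → ∀ u → side B u ≡ false → UniqueParents u (double m)
    N₂′≤|V₂|⇒uniqueParents N≤|V₂| u u∈V₂ = totalExcess≡0⇒uniqueParents u (double m) (n≤0⇒n≡0
      (+-cancelˡ-≤ |V₂| _ _ (≤-trans (≤-trans (|V₂|+totalExcess≤N₂′ u u∈V₂) N≤|V₂|) (≤-reflexive (sym (+-identityʳ |V₂|))))))

    |V₂|<N₂′ : |V₂| < N₂′ r s m
    |V₂|<N₂′ with N₂′ r s m ≤? |V₂|
    ... | no  N≰|V₂| = ≰⇒> N≰|V₂|
    ... | yes N≤|V₂| with V₂-witness (≤-trans (s≤s z≤n) N≤|V₂|)
    ...   | u , u∈V₂ with V₁-neighbour (≤-trans (s≤s z≤n) 2≤s) u u∈V₂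
    ...     | v , _ , v∈V₁ = ⊥-elim (<⇒≱ (s*[1+s[r∸1]X]<r*[1+r[s∸1]X] r s (geomSum q m) s<r 2≤s) (begin
      r * (1 + r * (s ∸ 1) * geomSum q m) ≤⟨ *-monoʳ-≤ r (N₁≤|V₁| v v∈V₁ unique-v) ⟩
      r * |V₁|                            ≡⟨ r*|V₁|≡s*|V₂| ⟩
      s * |V₂|                            ≤⟨ *-monoʳ-≤ s (≤-trans (m≤m+n |V₂| _) (|V₂|+totalExcess≤N₂′ u u∈V₂)) ⟩
      s * N₂′ r s m                       ∎))
      where
      open ≤-Reasoning
      unique-v : UniqueParents v (double m)
      unique-v = uniqueParents-from-neighbours v (double m) λ w v~w →
        N₂′≤|V₂|⇒uniqueParents N≤|V₂| w (trans (side-adjacent v~w) (cong not v∈V₁))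

-- The reduced ratio ρ : σ = r : s

divℕ≡/ : ∀ x g .{{_ : NonZero g}} → divℕ x g ≡ x / g
divℕ≡/ x (suc g) = refl

divℕ-*-suc : ∀ c p → divℕ (c * suc p) (suc p) ≡ c
divℕ-*-suc c p = m*n/n≡m c (suc p)

module Ratio (r s : ℕ) (r≢0 : r ≢ 0) where

  instance
    gcd≢0 : NonZero (gcd r s)
    gcd≢0 = ≢-nonZero (gcd[m,n]≢0 r s (inj₁ r≢0))

  ρ*gcd≡r : ρ r s * gcd r s ≡ r
  ρ*gcd≡r = trans (cong (_* gcd r s) (divℕ≡/ r (gcd r s))) (m/n*n≡m (gcd[m,n]∣m r s))

  σ*gcd≡s : σ r s * gcd r s ≡ s
  σ*gcd≡s = trans (cong (_* gcd r s) (divℕ≡/ s (gcd r s))) (m/n*n≡m (gcd[m,n]∣n r s))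

  ρ≢0 : ρ r s ≢ 0
  ρ≢0 ρ≡0 = r≢0 (trans (sym ρ*gcd≡r) (cong (_* gcd r s) ρ≡0))

  instance
    ρ-nonZero : NonZero (ρ r s)
    ρ-nonZero = ≢-nonZero ρ≢0

  ρ∣r : ρ r s ∣ r
  ρ∣r = divides (gcd r s) (trans (sym ρ*gcd≡r) (*-comm (ρ r s) (gcd r s)))

  coprime-ρσ : Coprime (ρ r s) (σ r s)
  coprime-ρσ = subst₂ Coprime (sym (divℕ≡/ r (gcd r s))) (sym (divℕ≡/ s (gcd r s))) (coprime-/gcd r s)

  proportional⇒multiples : ∀ a b → r * a ≡ s * b → ∃ λ t → b ≡ t * ρ r s × a ≡ σ r s * t
  proportional⇒multiples a b r*a≡s*b = t , b≡t*ρ , *-cancelˡ-≡ a (σ r s * t) (ρ r s) (begin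
      ρ r s * a           ≡⟨ ρa≡σb ⟩
      σ r s * b           ≡⟨ cong (σ r s *_) b≡t*ρ ⟩
      σ r s * (t * ρ r s) ≡⟨ regroup (σ r s) t (ρ r s) ⟩
      ρ r s * (σ r s * t) ∎)
    where
    open ≡-Reasoning
    regroup : ∀ a t p → a * (t * p) ≡ p * (a * t)
    regroup = solve-∀
    common : ∀ g a c → g * (a * c) ≡ (a * g) * c
    common = solve-∀
    ρa≡σb : ρ r s * a ≡ σ r s * b
    ρa≡σb = *-cancelˡ-≡ (ρ r s * a) (σ r s * b) (gcd r s) (begin
      gcd r s * (ρ r s * a) ≡⟨ common (gcd r s) (ρ r s) a ⟩
      ρ r s * gcd r s * a   ≡⟨ cong (_* a) ρ*gcd≡r ⟩
      r * a                 ≡⟨ r*a≡s*b ⟩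
      s * b                 ≡⟨ cong (_* b) σ*gcd≡s ⟨
      σ r s * gcd r s * b   ≡⟨ common (gcd r s) (σ r s) b ⟨
      gcd r s * (σ r s * b) ∎)
    ρ∣b : ρ r s ∣ b
    ρ∣b = coprime-divisor coprime-ρσ (divides a (trans (sym ρa≡σb) (*-comm (ρ r s) a)))
    t : ℕ
    t = _∣_.quotient ρ∣b
    b≡t*ρ : b ≡ t * ρ r s
    b≡t*ρ = _∣_.equality ρ∣b

1≤geomSum : ∀ q m → 1 ≤ m → 1 ≤ geomSum q m
1≤geomSum q (suc zero)    _ = s≤s z≤n
1≤geomSum q (suc (suc m)) _ = ≤-trans (1≤geomSum q (suc m) (s≤s z≤n)) (m≤n+m _ (q ^ suc m))

[sX∸1]+N₂′≡r*sX : ∀ r s m → 1 ≤ r → 1 ≤ s * X r s m → (s * X r s m ∸ 1) + N₂′ r s m ≡ r * (s * X r s m)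
[sX∸1]+N₂′≡r*sX (suc r′) s m _ 1≤sX = begin
  (s * X r s m ∸ 1) + (1 + s * r′ * X r s m) ≡⟨ +-assoc (s * X r s m ∸ 1) 1 _ ⟨
  (s * X r s m ∸ 1) + 1 + s * r′ * X r s m   ≡⟨ cong (_+ s * r′ * X r s m) (m∸n+n≡m 1≤sX) ⟩
  s * X r s m + s * r′ * X r s m             ≡⟨ factor s r′ (X r s m) ⟩
  suc r′ * (s * X r s m)                     ∎
  where
  open ≡-Reasoning
  r : ℕ
  r = suc r′
  factor : ∀ s r′ x → s * x + s * r′ * x ≡ suc r′ * (s * x)
  factor = solve-∀

double≡2*m : ∀ m → 2 * m + 1 ≡ suc (double m)
double≡2*m zero    = refl
double≡2*m (suc m) = trans (shift m) (cong (λ k → suc (suc k)) (double≡2*m m))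
  where
  shift : ∀ m → 2 * suc m + 1 ≡ suc (suc (2 * m + 1))
  shift = solve-∀

ρ∣N₂′ : ∀ r s m → r ≢ 0 → 1 ≤ s → 1 ≤ m → ρ r s ∣ (s * X r s m ∸ 1) → ρ r s ∣ N₂′ r s m
ρ∣N₂′ r s m r≢0 1≤s 1≤m ρ∣sX∸1 = ∣m+n∣m⇒∣n ρ∣[sX∸1]+N₂′ ρ∣sX∸1
  where
  ρ∣[sX∸1]+N₂′ : ρ r s ∣ (s * X r s m ∸ 1) + N₂′ r s m
  ρ∣[sX∸1]+N₂′ = subst (ρ r s ∣_) (sym ([sX∸1]+N₂′≡r*sX r s m (n≢0⇒n>0 r≢0) (*-mono-≤ 1≤s (1≤geomSum _ m 1≤m))))
                   (∣m⇒∣m*n (s * X r s m) (Ratio.ρ∣r r s r≢0))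

bounds-from-multiples : ∀ {n a b p q t N} → p ≢ 0 → p ∣ N → n ≡ a + b → b ≡ t * p → a ≡ q * t → b < N →
                        (n ≢ divℕ N p * (p + q)) × (a ≤ (divℕ N p ∸ 1) * q) ×
                        (b ≤ (divℕ N p ∸ 1) * p) × (n ≤ (divℕ N p ∸ 1) * (p + q))
bounds-from-multiples {p = zero}             p≢0 _ _ _ _ _ = ⊥-elim (p≢0 refl)
bounds-from-multiples {p = suc p′} {N = zero} _   _ _ _ _ ()
bounds-from-multiples {n} {a} {b} {suc p′} {q} {t} p≢0 (divides (suc c′) refl) refl refl refl b<N
  rewrite divℕ-*-suc (suc c′) p′ = n≢M , a≤ , b≤ , n≤
  where
  p : ℕ
  p = suc p′
  t≤c′ : t ≤ c′
  t≤c′ = <⇒≤pred (*-cancelʳ-< p t (suc c′) b<N)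
  a≤ : q * t ≤ c′ * q
  a≤ = subst (_≤ c′ * q) (*-comm t q) (*-monoˡ-≤ q t≤c′)
  b≤ : t * p ≤ c′ * p
  b≤ = *-monoˡ-≤ p t≤c′
  n≤ : q * t + t * p ≤ c′ * (p + q)
  n≤ = subst (q * t + t * p ≤_) (trans (+-comm (c′ * q) (c′ * p)) (sym (*-distribˡ-+ c′ p q))) (+-mono-≤ a≤ b≤)
  n≢M : q * t + t * p ≢ suc c′ * (p + q)
  n≢M n≡M = <⇒≱ (m<n+m (c′ * (p + q)) (s≤s z≤n)) (subst (_≤ c′ * (p + q)) n≡M n≤)

theorem2p5 : (r s m : ℕ) → s < r → 2 ≤ s → 1 ≤ m →
    ρ r s ∣ (s * X r s m ∸ 1) →
    (n : ℕ) (G : SimpleGraph n) (B : BiregularBipartite n r s G) →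
    HasDiameter G (2 * m + 1) →
    (n ≢ M r s m)
    × (sizeV₁ B ≤ K r s m * σ r s)
    × (sizeV₂ B ≤ K r s m * ρ r s)
    × (n ≤ M* r s m)
theorem2p5 r s m s<r 2≤s 1≤m ρ∣sX∸1 n G B (reach , _) =
  bounds-from-multiples ρ≢0 (ρ∣N₂′ r s m r≢0 1≤s 1≤m ρ∣sX∸1) order≡|V₁|+|V₂|
    (proj₁ (proj₂ multiples)) (proj₂ (proj₂ multiples)) (|V₂|<N₂′ m s<r 2≤s reach′)
  where
  open BiregularBipartiteGraph G B
  1≤s : 1 ≤ s
  1≤s = ≤-trans (s≤s z≤n) 2≤s
  r≢0 : r ≢ 0
  r≢0 = >⇒≢ (≤-<-trans z≤n s<r)
  open Ratio r s r≢0
  multiples : ∃ λ t → |V₂| ≡ t * ρ r s × |V₁| ≡ σ r s * t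
  multiples = proportional⇒multiples |V₁| |V₂| r*|V₁|≡s*|V₂|
  reach′ : ∀ u y → Σ ℕ λ k → k ≤ suc (double m) × Walk G u y k
  reach′ u y with reach u y
  ... | k , k≤2m+1 , walk = k , subst (k ≤_) (double≡2*m m) k≤2m+1 , walk
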